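{- Let $v$ be a positive integer and let $M$ be an integer with $\frac{v}{2}\left(\frac{v}{2}-1\right)\le M\le\binom{v}{2}$. If there exists a uniform nested SQS$(v)$ with exactly $M$ ND-pairs, then $v$ divides $2M$.
   Context: A Steiner quadruple system SQS$(v)$ is a pair $(Q,\mathcal{B})$ where $Q$ is a set of $v$ points and $\mathcal{B}$ is a collection of 4-subsets of $Q$ (blocks) such that every 3-subset of $Q$ is contained in exactly one block. A nested SQS$(v)$ is an SQS$(v)$ together with a partition of each block into two 2-subsets (pairs). A pair of points is an ND-pair if it is one of the two pairs in the partition of at least one block; the multiplicity of a pair is the number of blocks whose partition contains that pair. A nested SQS is uniform if all its ND-pairs have the same multiplicity. -}

module Defs where

open import Data.Nat using (ℕ; _<_; _≤_; _<?_; _≤?_)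
open import Data.Fin using (Fin; toℕ)
open import Data.Fin.Properties using (_≟_)
open import Data.List using (List; length; filter; allFin; cartesianProduct)
open import Data.Product using (_×_; _,_; Σ; ∃)
open import Data.Sum using (_⊎_)
open import Relation.Binary.PropositionalEquality using (_≡_; _≢_)
open import Relation.Nullary using (Dec; ¬_)
open import Relation.Nullary.Decidable using (_×-dec_; _⊎-dec_)

-- A nested block on the point set Fin v: four distinct points a, b, c, d,
-- whose block {a,b,c,d} is partitioned into the two pairs {a,b} and {c,d}.
record NBlock (v : ℕ) : Set where
  field
    a b c d : Fin v
    a≢b : a ≢ b
    a≢c : a ≢ c
    a≢d : a ≢ d
    b≢c : b ≢ c
    b≢d : b ≢ d
    c≢d : c ≢ d
open NBlock public

_∈B_ : ∀ {v} → Fin v → NBlock v → Set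
x ∈B B = (x ≡ a B) ⊎ (x ≡ b B) ⊎ (x ≡ c B) ⊎ (x ≡ d B)

_∈B?_ : ∀ {v} (x : Fin v) (B : NBlock v) → Dec (x ∈B B)
x ∈B? B = (x ≟ a B) ⊎-dec (x ≟ b B) ⊎-dec (x ≟ c B) ⊎-dec (x ≟ d B)

SamePair : ∀ {v} → Fin v → Fin v → Fin v → Fin v → Set
SamePair x y p q = ((x ≡ p) × (y ≡ q)) ⊎ ((x ≡ q) × (y ≡ p))

samePair? : ∀ {v} (x y p q : Fin v) → Dec (SamePair x y p q)
samePair? x y p q = ((x ≟ p) ×-dec (y ≟ q)) ⊎-dec ((x ≟ q) ×-dec (y ≟ p))

PairOf : ∀ {v} → Fin v → Fin v → NBlock v → Set
PairOf x y B = SamePair x y (a B) (b B) ⊎ SamePair x y (c B) (d B)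

pairOf? : ∀ {v} (x y : Fin v) (B : NBlock v) → Dec (PairOf x y B)
pairOf? x y B = samePair? x y (a B) (b B) ⊎-dec samePair? x y (c B) (d B)

record NestedDesign (v : ℕ) : Set where
  field
    n      : ℕ
    blocks : Fin n → NBlock v
open NestedDesign public

tripleCount : ∀ {v} → NestedDesign v → Fin v → Fin v → Fin v → ℕ
tripleCount D x y z =
  length (filter (λ i → (x ∈B? blocks D i) ×-dec (y ∈B? blocks D i) ×-dec (z ∈B? blocks D i))
                 (allFin (n D)))

IsNestedSQS : ∀ {v} → NestedDesign v → Set
IsNestedSQS D = ∀ x y z → x ≢ y → x ≢ z → y ≢ z → tripleCount D x y z ≡ 1

multiplicity : ∀ {v} → NestedDesign v → Fin v → Fin v → ℕ
multiplicity D x y = length (filter (λ i → pairOf? x y (blocks D i)) (allFin (n D)))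

IsNDPair : ∀ {v} → NestedDesign v → Fin v → Fin v → Set
IsNDPair D x y = x ≢ y × 1 ≤ multiplicity D x y

-- number of ND-pairs, each unordered pair {x,y} counted once via toℕ x < toℕ y
numNDPairs : ∀ {v} → NestedDesign v → ℕ
numNDPairs {v} D =
  length (filter (λ p → (toℕ (Data.Product.proj₁ p) <? toℕ (Data.Product.proj₂ p))
                         ×-dec (1 ≤? multiplicity D (Data.Product.proj₁ p) (Data.Product.proj₂ p)))
                 (cartesianProduct (allFin v) (allFin v)))

IsUniform : ∀ {v} → NestedDesign v → Set
IsUniform D = Σ ℕ λ λ₀ → ∀ x y → IsNDPair D x y → multiplicity D x y ≡ λ₀

{-# OPTIONS --safe #-}
-- Let r x (replication) be the number of blocks through x and deg x (ndDegree) the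
-- number of ND-pairs containing x. A block through x pairs x with exactly one other
-- point, so if every ND-pair has multiplicity λ then deg x * λ = r x. Counting the
-- ordered pairs (y , z) completing x to a 3-set, each 3-set lying in exactly one block
-- and each block through x supplying 3 * 2 of them, gives 6 * r x = (v - 1) * (v - 2).
-- Hence r, and with it deg, is independent of x (deg vanishes when λ = 0), and
-- 2 M = Σ deg = v * deg x₀.
module Submission where

open import Defs
open import Data.Nat using (ℕ; _*_; _∸_; _≤_)
open import Data.Nat.Divisibility using (_∣_)
open import Data.Nat.Combinatorics using (_C_)
open import Data.Product using (Σ; _×_)
open import Relation.Binary.PropositionalEquality using (_≡_)

open import Level using (Level)
open import Data.Bool using (if_then_else_; true; false)
open import Data.Nat using (zero; suc; _+_; _<_; _<?_; _≤?_)
open import Data.Nat.Properties as ℕ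
  using (+-assoc; +-identityʳ; *-identityˡ; *-identityʳ; *-comm; *-cancelˡ-≡; *-cancelʳ-≡; ≰⇒>; n<1⇒n≡0)
open import Data.Nat.Divisibility using (divides; _∣0)
open import Data.Fin using (Fin; toℕ; zero; suc)
open import Data.Fin.Properties using (_≟_; <-cmp; <-asym; <-irrefl)
open import Data.List using (List; _++_; filter; length; map; tabulate; allFin; cartesianProduct)
open import Data.List.Properties using (filter-++; length-++; map-tabulate; filter-≐)
open import Data.Product using (_,_; proj₁; proj₂)
open import Data.Sum as Sum using (_⊎_; inj₁; inj₂; [_,_])
open import Data.Unit using (tt)
open import Function using (_∘_; id)
open import Relation.Binary.Core using (Rel)
open import Relation.Binary.Definitions using (Symmetric; Irreflexive; tri<; tri≈; tri>)
open import Relation.Binary.PropositionalEquality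
  using (_≢_; refl; sym; trans; cong; cong₂; subst; ≢-sym; module ≡-Reasoning)
open import Relation.Nullary using (Dec; does; yes; no; ¬_; ¬?; contradiction)
open import Relation.Nullary.Decidable using (_×-dec_; _⊎-dec_)
open import Relation.Unary using (Pred; Decidable; U)
open import Relation.Unary.Properties using (U?)
open import Algebra.Properties.Semiring.Sum ℕ.+-*-semiring
  using (sum-syntax; sum-cong-≗; sum-replicate-zero; ∑-distrib-+; ∑-comm; *-distribˡ-sum; *-distribʳ-sum)

open ≡-Reasoning

private
  variable
    ℓ ℓ′ : Level
    A B : Set ℓ
    k l m v : ℕ

-- Counting over Fin m

𝟙 : Dec A → ℕ
𝟙 A? = if does A? then 1 else 0

𝟙-yes : A → (A? : Dec A) → 𝟙 A? ≡ 1
𝟙-yes _ (yes _) = refl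
𝟙-yes a (no ¬a) = contradiction a ¬a

𝟙-no : ¬ A → (A? : Dec A) → 𝟙 A? ≡ 0
𝟙-no ¬a (yes a) = contradiction a ¬a
𝟙-no _  (no _)  = refl

𝟙-cong : (A → B) → (B → A) → (A? : Dec A) (B? : Dec B) → 𝟙 A? ≡ 𝟙 B?
𝟙-cong f g (yes a) B? = sym (𝟙-yes (f a) B?)
𝟙-cong f g (no ¬a) B? = sym (𝟙-no (¬a ∘ g) B?)

𝟙-× : (A? : Dec A) (B? : Dec B) → 𝟙 (A? ×-dec B?) ≡ 𝟙 A? * 𝟙 B?
𝟙-× (yes _) (yes _) = refl
𝟙-× (yes _) (no _)  = refl
𝟙-× (no _)  _       = refl

𝟙-⊎ : (A? : Dec A) (B? : Dec B) → ¬ (A × B) → 𝟙 (A? ⊎-dec B?) ≡ 𝟙 A? + 𝟙 B?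
𝟙-⊎ (yes a) (yes b) disjoint = contradiction (a , b) disjoint
𝟙-⊎ (yes _) (no _)  _        = refl
𝟙-⊎ (no _)  _       _        = refl

𝟙*-cong : (A? : Dec A) → (A → k ≡ l) → 𝟙 A? * k ≡ 𝟙 A? * l
𝟙*-cong (yes a) k≡l = cong (1 *_) (k≡l a)
𝟙*-cong (no _)  _   = refl

≡𝟙* : (A? : Dec A) → (A → k ≡ l) → (¬ A → k ≡ 0) → k ≡ 𝟙 A? * l
≡𝟙* {l = l} (yes a) k≡l _ = trans (k≡l a) (sym (*-identityˡ l))
≡𝟙* (no ¬a) _ k≡0 = k≡0 ¬a

∑-const : ∀ m k → ∑[ i < m ] k ≡ m * k
∑-const zero    k = refl
∑-const (suc m) k = cong (k +_) (∑-const m k)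

count : {P : Pred (Fin m) ℓ} → Decidable P → ℕ
count {m = m} P? = ∑[ i < m ] 𝟙 (P? i)

module _ {P : Pred (Fin m) ℓ} (P? : Decidable P) where

  count-cong : {Q : Pred (Fin m) ℓ′} (Q? : Decidable Q) →
               (∀ i → P i → Q i) → (∀ i → Q i → P i) → count P? ≡ count Q?
  count-cong Q? P⇒Q Q⇒P = sum-cong-≗ (λ i → 𝟙-cong (P⇒Q i) (Q⇒P i) (P? i) (Q? i))

  count-none : (∀ i → ¬ P i) → count P? ≡ 0
  count-none ¬P = trans (sum-cong-≗ (λ i → 𝟙-no (¬P i) (P? i))) (sum-replicate-zero m)

  count-all : (∀ i → P i) → count P? ≡ m
  count-all allP = begin
    count P?        ≡⟨ sum-cong-≗ (λ i → 𝟙-yes (allP i) (P? i)) ⟩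
    ∑[ i < m ] 1    ≡⟨ ∑-const m 1 ⟩
    m * 1           ≡⟨ *-identityʳ m ⟩
    m               ∎

  count-⊎ : {Q : Pred (Fin m) ℓ′} (Q? : Decidable Q) → (∀ i → ¬ (P i × Q i)) →
            count (λ i → P? i ⊎-dec Q? i) ≡ count P? + count Q?
  count-⊎ Q? disjoint =
    trans (sum-cong-≗ (λ i → 𝟙-⊎ (P? i) (Q? i) (disjoint i))) (∑-distrib-+ (𝟙 ∘ P?) (𝟙 ∘ Q?))

count-const-× : {A : Set ℓ} {P : Pred (Fin m) ℓ′} (A? : Dec A) (P? : Decidable P) →
                count (λ i → A? ×-dec P? i) ≡ 𝟙 A? * count P?
count-const-× A? P? =
  trans (sum-cong-≗ (λ i → 𝟙-× A? (P? i))) (sym (*-distribˡ-sum (𝟙 A?) (λ i → 𝟙 (P? i))))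

count-≟ : (j : Fin m) → count (_≟ j) ≡ 1
count-≟ {suc m} zero    = cong suc (sum-replicate-zero m)
count-≟ {suc m} (suc j) = count-≟ j

count-remove : {P : Pred (Fin m) ℓ} (P? : Decidable P) {j : Fin m} → P j →
               count P? ≡ suc (count (λ i → P? i ×-dec ¬? (i ≟ j)))
count-remove {P = P} P? {j} Pj = begin
  count P?                             ≡⟨ count-cong P? (λ i → (i ≟ j) ⊎-dec Rest? i) split join ⟩
  count (λ i → (i ≟ j) ⊎-dec Rest? i)  ≡⟨ count-⊎ (_≟ j) Rest? (λ i (i≡j , _ , i≢j) → i≢j i≡j) ⟩
  count (_≟ j) + count Rest?           ≡⟨ cong (_+ count Rest?) (count-≟ j) ⟩
  suc (count Rest?)                    ∎
  where
  Rest? : Decidable (λ i → P i × i ≢ j)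
  Rest? i = P? i ×-dec ¬? (i ≟ j)
  split : ∀ i → P i → i ≡ j ⊎ (P i × i ≢ j)
  split i Pi with i ≟ j
  ... | yes i≡j = inj₁ i≡j
  ... | no i≢j  = inj₂ (Pi , i≢j)
  join : ∀ i → i ≡ j ⊎ (P i × i ≢ j) → P i
  join i (inj₁ refl)     = Pj
  join i (inj₂ (Pi , _)) = Pi

Distinct? : (x y z : Fin m) → Dec (x ≢ y × x ≢ z × y ≢ z)
Distinct? x y z = ¬? (x ≟ y) ×-dec ¬? (x ≟ z) ×-dec ¬? (y ≟ z)

∑∑-distinct-within : {In : Pred (Fin m) ℓ} (In? : Decidable In) → count In? ≡ k → (x : Fin m) →
  ∑[ y < m ] ∑[ z < m ] 𝟙 (Distinct? x y z ×-dec In? x ×-dec In? y ×-dec In? z)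
    ≡ 𝟙 (In? x) * ((k ∸ 1) * (k ∸ 2))
∑∑-distinct-within {m = m} {k = k} {In = In} In? count≡k x = ≡𝟙* (In? x) within outside
  where
  Triple? : ∀ y z → Dec ((x ≢ y × x ≢ z × y ≢ z) × In x × In y × In z)
  Triple? y z = Distinct? x y z ×-dec In? x ×-dec In? y ×-dec In? z

  outside : ¬ In x → ∑[ y < m ] count (Triple? y) ≡ 0
  outside ¬Ix = trans (sum-cong-≗ (λ y → count-none (Triple? y) (λ z t → ¬Ix (proj₁ (proj₂ t)))))
                      (sum-replicate-zero m)

  within : In x → ∑[ y < m ] count (Triple? y) ≡ (k ∸ 1) * (k ∸ 2)
  within Ix = begin
    ∑[ y < m ] ∑[ z < m ] 𝟙 (Triple? y z)
      ≡⟨ sum-cong-≗ (λ y → sum-cong-≗ (λ z →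
           trans (𝟙-cong reorder restore (Triple? y z) (Second? y ×-dec Third? y z)) (𝟙-× (Second? y) (Third? y z)))) ⟩
    ∑[ y < m ] ∑[ z < m ] (𝟙 (Second? y) * 𝟙 (Third? y z))
      ≡⟨ sum-cong-≗ (λ y → sym (*-distribˡ-sum (𝟙 (Second? y)) (λ z → 𝟙 (Third? y z)))) ⟩
    ∑[ y < m ] (𝟙 (Second? y) * count (Third? y))
      ≡⟨ sum-cong-≗ (λ y → 𝟙*-cong (Second? y) (count-Third y)) ⟩
    ∑[ y < m ] (𝟙 (Second? y) * (k ∸ 2))
      ≡⟨ sym (*-distribʳ-sum (k ∸ 2) (λ y → 𝟙 (Second? y))) ⟩
    count Second? * (k ∸ 2)
      ≡⟨ cong (λ c → (c ∸ 1) * (k ∸ 2)) (sym k≡1+count-Second) ⟩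
    (k ∸ 1) * (k ∸ 2)
      ∎
    where
    Second? : Decidable (λ y → In y × y ≢ x)
    Second? y = In? y ×-dec ¬? (y ≟ x)
    Third? : (y : Fin m) → Decidable (λ z → (In z × z ≢ x) × z ≢ y)
    Third? y z = Second? z ×-dec ¬? (z ≟ y)

    reorder : ∀ {y z} → (x ≢ y × x ≢ z × y ≢ z) × In x × In y × In z →
              (In y × y ≢ x) × (In z × z ≢ x) × z ≢ y
    reorder ((x≢y , x≢z , y≢z) , _ , Iy , Iz) = (Iy , ≢-sym x≢y) , (Iz , ≢-sym x≢z) , ≢-sym y≢z
    restore : ∀ {y z} → (In y × y ≢ x) × (In z × z ≢ x) × z ≢ y →
              (x ≢ y × x ≢ z × y ≢ z) × In x × In y × In z
    restore ((Iy , y≢x) , (Iz , z≢x) , z≢y) = (≢-sym y≢x , ≢-sym z≢x , ≢-sym z≢y) , Ix , Iy , Iz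

    k≡1+count-Second : k ≡ suc (count Second?)
    k≡1+count-Second = trans (sym count≡k) (count-remove In? Ix)
    count-Third : ∀ y → In y × y ≢ x → count (Third? y) ≡ k ∸ 2
    count-Third y Second-y =
      cong (_∸ 2) (sym (trans k≡1+count-Second (cong suc (count-remove Second? Second-y))))

∑∑-distinct : (x : Fin m) → ∑[ y < m ] ∑[ z < m ] 𝟙 (Distinct? x y z) ≡ (m ∸ 1) * (m ∸ 2)
∑∑-distinct {m = m} x = begin
  ∑[ y < m ] ∑[ z < m ] 𝟙 (Distinct? x y z)
    ≡⟨ sum-cong-≗ (λ y → sum-cong-≗ (λ z →
         𝟙-cong (_, _) proj₁ (Distinct? x y z) (Everywhere? y z))) ⟩
  ∑[ y < m ] ∑[ z < m ] 𝟙 (Everywhere? y z)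
    ≡⟨ ∑∑-distinct-within U? (count-all {m = m} U? (λ _ → tt)) x ⟩
  1 * ((m ∸ 1) * (m ∸ 2))
    ≡⟨ *-identityˡ _ ⟩
  (m ∸ 1) * (m ∸ 2)
    ∎
  where
  Everywhere? : ∀ y z → Dec ((x ≢ y × x ≢ z × y ≢ z) × U x × U y × U z)
  Everywhere? y z = Distinct? x y z ×-dec U? x ×-dec U? y ×-dec U? z

module _ {R : Rel (Fin m) ℓ} (R? : ∀ x y → Dec (R x y))
         (R-sym : Symmetric R) (R-irrefl : Irreflexive _≡_ R) where

  2*∑∑-upper≡∑∑ : 2 * ∑[ x < m ] ∑[ y < m ] 𝟙 ((toℕ x <? toℕ y) ×-dec R? x y)
                  ≡ ∑[ x < m ] ∑[ y < m ] 𝟙 (R? x y)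
  2*∑∑-upper≡∑∑ = begin
    2 * ∑[ x < m ] ∑[ y < m ] upper x y
      ≡⟨ cong (∑upper +_) (+-identityʳ ∑upper) ⟩
    ∑upper + ∑[ x < m ] ∑[ y < m ] upper x y
      ≡⟨ cong (∑upper +_) (∑-comm upper) ⟩
    ∑upper + ∑[ x < m ] ∑[ y < m ] upper y x
      ≡⟨ ∑-distrib-+ (λ x → ∑[ y < m ] upper x y) (λ x → ∑[ y < m ] upper y x) ⟨
    ∑[ x < m ] (∑[ y < m ] upper x y + ∑[ y < m ] upper y x)
      ≡⟨ sum-cong-≗ (λ x → ∑-distrib-+ (upper x) (λ y → upper y x)) ⟨
    ∑[ x < m ] ∑[ y < m ] (upper x y + upper y x)
      ≡⟨ sum-cong-≗ (λ x → sum-cong-≗ (halves x)) ⟩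
    ∑[ x < m ] ∑[ y < m ] 𝟙 (R? x y)
      ∎
    where
    Upper? : ∀ x y → Dec (toℕ x < toℕ y × R x y)
    Upper? x y = (toℕ x <? toℕ y) ×-dec R? x y
    upper : Fin m → Fin m → ℕ
    upper x y = 𝟙 (Upper? x y)
    ∑upper : ℕ
    ∑upper = ∑[ x < m ] ∑[ y < m ] upper x y

    halves : ∀ x y → upper x y + upper y x ≡ 𝟙 (R? x y)
    halves x y with <-cmp x y
    ... | tri< x<y _ _ = trans (cong₂ _+_ (𝟙-cong proj₂ (x<y ,_) (Upper? x y) (R? x y))
                                           (𝟙-no (<-asym x<y ∘ proj₁) (Upper? y x)))
                               (+-identityʳ _)
    ... | tri≈ _ refl _ = trans (cong₂ _+_ (𝟙-no (<-irrefl refl ∘ proj₁) (Upper? x x))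
                                            (𝟙-no (<-irrefl refl ∘ proj₁) (Upper? x x)))
                                (sym (𝟙-no (R-irrefl refl) (R? x y)))
    ... | tri> _ _ y<x = cong₂ _+_ (𝟙-no (<-asym y<x ∘ proj₁) (Upper? x y))
                                   (𝟙-cong (R-sym ∘ proj₂) (λ r → y<x , R-sym r) (Upper? y x) (R? x y))

length-filter-tabulate : {P : Pred A ℓ} (P? : Decidable P) (f : Fin m → A) →
                         length (filter P? (tabulate f)) ≡ ∑[ i < m ] 𝟙 (P? (f i))
length-filter-tabulate {m = zero}  P? f = refl
length-filter-tabulate {m = suc m} P? f with does (P? (f zero))
... | true  = cong suc (length-filter-tabulate P? (f ∘ suc))
... | false = length-filter-tabulate P? (f ∘ suc)

length-filter-allFin : {P : Pred (Fin m) ℓ} (P? : Decidable P) → length (filter P? (allFin m)) ≡ count P?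
length-filter-allFin P? = length-filter-tabulate P? id

length-filter-cartesianProduct : {P : Pred (A × B) ℓ} (P? : Decidable P) (f : Fin m → A) (g : Fin k → B) →
  length (filter P? (cartesianProduct (tabulate f) (tabulate g))) ≡ ∑[ i < m ] ∑[ j < k ] 𝟙 (P? (f i , g j))
length-filter-cartesianProduct {m = zero}  P? f g = refl
length-filter-cartesianProduct {A = A} {B = B} {m = suc m} {k = k} P? f g = begin
  length (filter P? (row ++ rest))
    ≡⟨ cong length (filter-++ P? row rest) ⟩
  length (filter P? row ++ filter P? rest)
    ≡⟨ length-++ (filter P? row) ⟩
  length (filter P? row) + length (filter P? rest)
    ≡⟨ cong₂ _+_ count-row (length-filter-cartesianProduct P? (f ∘ suc) g) ⟩
  ∑[ j < k ] 𝟙 (P? (f zero , g j)) + ∑[ i < m ] ∑[ j < k ] 𝟙 (P? (f (suc i) , g j))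
    ∎
  where
  row rest : List (A × B)
  row  = map (f zero ,_) (tabulate g)
  rest = cartesianProduct (tabulate (f ∘ suc)) (tabulate g)
  count-row : length (filter P? row) ≡ ∑[ j < k ] 𝟙 (P? (f zero , g j))
  count-row = trans (cong (length ∘ filter P?) (map-tabulate g (f zero ,_)))
                    (length-filter-tabulate P? ((f zero ,_) ∘ g))

-- Pairs and points of a nested block

≢⇒disjoint : {p q x : Fin m} → p ≢ q → ¬ (x ≡ p × x ≡ q)
≢⇒disjoint p≢q (refl , x≡q) = p≢q x≡q

samePair-sym : {x y p q : Fin m} → SamePair x y p q → SamePair y x p q
samePair-sym (inj₁ (x≡p , y≡q)) = inj₂ (y≡q , x≡p)
samePair-sym (inj₂ (x≡q , y≡p)) = inj₁ (y≡p , x≡q)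

samePair-irrefl : {x p q : Fin m} → p ≢ q → ¬ SamePair x x p q
samePair-irrefl p≢q (inj₁ (x≡p , x≡q)) = ≢⇒disjoint p≢q (x≡p , x≡q)
samePair-irrefl p≢q (inj₂ (x≡q , x≡p)) = ≢⇒disjoint p≢q (x≡p , x≡q)

samePair⇒≡⊎≡ : {x y p q : Fin m} → SamePair x y p q → x ≡ p ⊎ x ≡ q
samePair⇒≡⊎≡ (inj₁ (x≡p , _)) = inj₁ x≡p
samePair⇒≡⊎≡ (inj₂ (x≡q , _)) = inj₂ x≡q

count-samePair : {p q : Fin m} → p ≢ q → (x : Fin m) →
                 count (λ y → samePair? x y p q) ≡ 𝟙 (x ≟ p) + 𝟙 (x ≟ q)
count-samePair {p = p} {q} p≢q x = begin
  count (λ y → samePair? x y p q)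
    ≡⟨ count-⊎ (λ y → (x ≟ p) ×-dec (y ≟ q)) (λ y → (x ≟ q) ×-dec (y ≟ p))
               (λ y ((x≡p , _) , (x≡q , _)) → ≢⇒disjoint p≢q (x≡p , x≡q)) ⟩
  count (λ y → (x ≟ p) ×-dec (y ≟ q)) + count (λ y → (x ≟ q) ×-dec (y ≟ p))
    ≡⟨ cong₂ _+_ (count-const-× (x ≟ p) (_≟ q)) (count-const-× (x ≟ q) (_≟ p)) ⟩
  𝟙 (x ≟ p) * count (_≟ q) + 𝟙 (x ≟ q) * count (_≟ p)
    ≡⟨ cong₂ (λ c c′ → 𝟙 (x ≟ p) * c + 𝟙 (x ≟ q) * c′) (count-≟ q) (count-≟ p) ⟩
  𝟙 (x ≟ p) * 1 + 𝟙 (x ≟ q) * 1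
    ≡⟨ cong₂ _+_ (*-identityʳ (𝟙 (x ≟ p))) (*-identityʳ (𝟙 (x ≟ q))) ⟩
  𝟙 (x ≟ p) + 𝟙 (x ≟ q)
    ∎

module _ (B : NBlock v) where

  pairOf-sym : {x y : Fin v} → PairOf x y B → PairOf y x B
  pairOf-sym = Sum.map samePair-sym samePair-sym

  pairOf-irrefl : {x : Fin v} → ¬ PairOf x x B
  pairOf-irrefl = [ samePair-irrefl (a≢b B) , samePair-irrefl (c≢d B) ]

  private
    a∉bcd : ∀ x → ¬ (x ≡ a B × (x ≡ b B ⊎ x ≡ c B ⊎ x ≡ d B))
    a∉bcd x (x≡a , inj₁ x≡b)        = ≢⇒disjoint (a≢b B) (x≡a , x≡b)
    a∉bcd x (x≡a , inj₂ (inj₁ x≡c)) = ≢⇒disjoint (a≢c B) (x≡a , x≡c)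
    a∉bcd x (x≡a , inj₂ (inj₂ x≡d)) = ≢⇒disjoint (a≢d B) (x≡a , x≡d)

    b∉cd : ∀ x → ¬ (x ≡ b B × (x ≡ c B ⊎ x ≡ d B))
    b∉cd x (x≡b , inj₁ x≡c) = ≢⇒disjoint (b≢c B) (x≡b , x≡c)
    b∉cd x (x≡b , inj₂ x≡d) = ≢⇒disjoint (b≢d B) (x≡b , x≡d)

    c∉d : ∀ x → ¬ (x ≡ c B × x ≡ d B)
    c∉d x = ≢⇒disjoint (c≢d B)

  𝟙-∈B : (x : Fin v) →
         𝟙 (x ∈B? B) ≡ 𝟙 (x ≟ a B) + (𝟙 (x ≟ b B) + (𝟙 (x ≟ c B) + 𝟙 (x ≟ d B)))
  𝟙-∈B x =
    trans (𝟙-⊎ (x ≟ a B) ((x ≟ b B) ⊎-dec (x ≟ c B) ⊎-dec (x ≟ d B)) (a∉bcd x))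
    (cong (𝟙 (x ≟ a B) +_)
    (trans (𝟙-⊎ (x ≟ b B) ((x ≟ c B) ⊎-dec (x ≟ d B)) (b∉cd x))
    (cong (𝟙 (x ≟ b B) +_)
           (𝟙-⊎ (x ≟ c B) (x ≟ d B) (c∉d x)))))

  count-∈B : count (_∈B? B) ≡ 4
  count-∈B = begin
    count (_∈B? B)
      ≡⟨ sum-cong-≗ 𝟙-∈B ⟩
    ∑[ x < v ] (𝟙 (x ≟ a B) + (𝟙 (x ≟ b B) + (𝟙 (x ≟ c B) + 𝟙 (x ≟ d B))))
      ≡⟨ ∑-distrib-+ (𝟙 ∘ (_≟ a B)) _ ⟩
    count (_≟ a B) + ∑[ x < v ] (𝟙 (x ≟ b B) + (𝟙 (x ≟ c B) + 𝟙 (x ≟ d B)))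
      ≡⟨ cong₂ _+_ (count-≟ (a B)) (∑-distrib-+ (𝟙 ∘ (_≟ b B)) _) ⟩
    1 + (count (_≟ b B) + ∑[ x < v ] (𝟙 (x ≟ c B) + 𝟙 (x ≟ d B)))
      ≡⟨ cong (1 +_) (cong₂ _+_ (count-≟ (b B)) (∑-distrib-+ (𝟙 ∘ (_≟ c B)) (𝟙 ∘ (_≟ d B)))) ⟩
    2 + (count (_≟ c B) + count (_≟ d B))
      ≡⟨ cong (2 +_) (cong₂ _+_ (count-≟ (c B)) (count-≟ (d B))) ⟩
    4 ∎

  count-partners : (x : Fin v) → count (λ y → pairOf? x y B) ≡ 𝟙 (x ∈B? B)
  count-partners x = begin
    count (λ y → pairOf? x y B)
      ≡⟨ count-⊎ (λ y → samePair? x y (a B) (b B)) (λ y → samePair? x y (c B) (d B)) apart ⟩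
    count (λ y → samePair? x y (a B) (b B)) + count (λ y → samePair? x y (c B) (d B))
      ≡⟨ cong₂ _+_ (count-samePair (a≢b B) x) (count-samePair (c≢d B) x) ⟩
    (𝟙 (x ≟ a B) + 𝟙 (x ≟ b B)) + (𝟙 (x ≟ c B) + 𝟙 (x ≟ d B))
      ≡⟨ +-assoc (𝟙 (x ≟ a B)) _ _ ⟩
    𝟙 (x ≟ a B) + (𝟙 (x ≟ b B) + (𝟙 (x ≟ c B) + 𝟙 (x ≟ d B)))
      ≡⟨ 𝟙-∈B x ⟨
    𝟙 (x ∈B? B)
      ∎
    where
    apart : ∀ y → ¬ (SamePair x y (a B) (b B) × SamePair x y (c B) (d B))
    apart y (ab , cd) with samePair⇒≡⊎≡ ab
    ... | inj₁ x≡a = a∉bcd x (x≡a , inj₂ (samePair⇒≡⊎≡ cd))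
    ... | inj₂ x≡b = b∉cd x (x≡b , samePair⇒≡⊎≡ cd)

  ∑∑-distinct-in-block : (x : Fin v) →
    ∑[ y < v ] ∑[ z < v ] 𝟙 (Distinct? x y z ×-dec x ∈B? B ×-dec y ∈B? B ×-dec z ∈B? B)
      ≡ 6 * 𝟙 (x ∈B? B)
  ∑∑-distinct-in-block x = trans (∑∑-distinct-within (_∈B? B) count-∈B x) (*-comm (𝟙 (x ∈B? B)) 6)

-- Double counting in a nested design

module _ (D : NestedDesign v) where

  replication : Fin v → ℕ
  replication x = count (λ i → x ∈B? blocks D i)

  ndDegree : Fin v → ℕ
  ndDegree x = count (λ y → 1 ≤? multiplicity D x y)

  multiplicity≡count : ∀ x y → multiplicity D x y ≡ count (λ i → pairOf? x y (blocks D i))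
  multiplicity≡count x y = length-filter-allFin (λ i → pairOf? x y (blocks D i))

  multiplicity-sym : ∀ x y → multiplicity D x y ≡ multiplicity D y x
  multiplicity-sym x y = cong length (filter-≐ (λ i → pairOf? x y (blocks D i)) (λ i → pairOf? y x (blocks D i))
    ((λ {i} → pairOf-sym (blocks D i)) , (λ {i} → pairOf-sym (blocks D i))) (allFin (n D)))

  multiplicity-diag : ∀ x → multiplicity D x x ≡ 0
  multiplicity-diag x = trans (multiplicity≡count x x)
                              (count-none (λ i → pairOf? x x (blocks D i)) (λ i → pairOf-irrefl (blocks D i)))

  1≤multiplicity-sym : Symmetric (λ x y → 1 ≤ multiplicity D x y)
  1≤multiplicity-sym {x} {y} = subst (1 ≤_) (multiplicity-sym x y)

  1≤multiplicity-irrefl : Irreflexive _≡_ (λ x y → 1 ≤ multiplicity D x y)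
  1≤multiplicity-irrefl {x} refl 1≤mxx = contradiction (subst (1 ≤_) (multiplicity-diag x) 1≤mxx) λ ()

  1≤multiplicity⇒IsNDPair : ∀ {x y} → 1 ≤ multiplicity D x y → IsNDPair D x y
  1≤multiplicity⇒IsNDPair 1≤m = (λ x≡y → 1≤multiplicity-irrefl x≡y 1≤m) , 1≤m

  2*numNDPairs≡∑ndDegree : 2 * numNDPairs D ≡ ∑[ x < v ] ndDegree x
  2*numNDPairs≡∑ndDegree =
    trans (cong (2 *_) (length-filter-cartesianProduct {m = v} {k = v} _ id id))
          (2*∑∑-upper≡∑∑ (λ x y → 1 ≤? multiplicity D x y) 1≤multiplicity-sym 1≤multiplicity-irrefl)

  ∑multiplicity≡replication : ∀ x → ∑[ y < v ] multiplicity D x y ≡ replication x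
  ∑multiplicity≡replication x = begin
    ∑[ y < v ] multiplicity D x y
      ≡⟨ sum-cong-≗ (multiplicity≡count x) ⟩
    ∑[ y < v ] ∑[ i < n D ] 𝟙 (pairOf? x y (blocks D i))
      ≡⟨ ∑-comm (λ y i → 𝟙 (pairOf? x y (blocks D i))) ⟩
    ∑[ i < n D ] ∑[ y < v ] 𝟙 (pairOf? x y (blocks D i))
      ≡⟨ sum-cong-≗ (λ i → count-partners (blocks D i) x) ⟩
    replication x
      ∎

  ndDegree*λ≡replication : {λ₀ : ℕ} → (∀ x y → IsNDPair D x y → multiplicity D x y ≡ λ₀) →
                           ∀ x → ndDegree x * λ₀ ≡ replication x
  ndDegree*λ≡replication {λ₀} uniform x = begin
    ndDegree x * λ₀
      ≡⟨ *-distribʳ-sum λ₀ (λ y → 𝟙 (1 ≤? multiplicity D x y)) ⟩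
    ∑[ y < v ] (𝟙 (1 ≤? multiplicity D x y) * λ₀)
      ≡⟨ sum-cong-≗ (λ y → ≡𝟙* (1 ≤? multiplicity D x y)
                                (uniform x y ∘ 1≤multiplicity⇒IsNDPair) (n<1⇒n≡0 ∘ ≰⇒>)) ⟨
    ∑[ y < v ] multiplicity D x y
      ≡⟨ ∑multiplicity≡replication x ⟩
    replication x
      ∎

  6*replication : IsNestedSQS D → ∀ x → 6 * replication x ≡ (v ∸ 1) * (v ∸ 2)
  6*replication sqs x = begin
    6 * replication x
      ≡⟨ *-distribˡ-sum 6 (λ i → 𝟙 (x ∈B? blocks D i)) ⟩
    ∑[ i < n D ] (6 * 𝟙 (x ∈B? blocks D i))
      ≡⟨ sum-cong-≗ (λ i → ∑∑-distinct-in-block (blocks D i) x) ⟨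
    ∑[ i < n D ] ∑[ y < v ] ∑[ z < v ] 𝟙 (Through? i y z)
      ≡⟨ ∑-comm (λ i y → ∑[ z < v ] 𝟙 (Through? i y z)) ⟩
    ∑[ y < v ] ∑[ i < n D ] ∑[ z < v ] 𝟙 (Through? i y z)
      ≡⟨ sum-cong-≗ (λ y → ∑-comm (λ i z → 𝟙 (Through? i y z))) ⟩
    ∑[ y < v ] ∑[ z < v ] ∑[ i < n D ] 𝟙 (Through? i y z)
      ≡⟨ sum-cong-≗ (λ y → sum-cong-≗ (one-block-through y)) ⟩
    ∑[ y < v ] ∑[ z < v ] 𝟙 (Distinct? x y z)
      ≡⟨ ∑∑-distinct x ⟩
    (v ∸ 1) * (v ∸ 2)
      ∎
    where
    Contains? : ∀ y z i → Dec (x ∈B blocks D i × y ∈B blocks D i × z ∈B blocks D i)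
    Contains? y z i = x ∈B? blocks D i ×-dec y ∈B? blocks D i ×-dec z ∈B? blocks D i
    Through? : ∀ i y z →
               Dec ((x ≢ y × x ≢ z × y ≢ z) × x ∈B blocks D i × y ∈B blocks D i × z ∈B blocks D i)
    Through? i y z = Distinct? x y z ×-dec Contains? y z i

    one-block-through : ∀ y z → ∑[ i < n D ] 𝟙 (Through? i y z) ≡ 𝟙 (Distinct? x y z)
    one-block-through y z = begin
      ∑[ i < n D ] 𝟙 (Through? i y z)
        ≡⟨ count-const-× (Distinct? x y z) (Contains? y z) ⟩
      𝟙 (Distinct? x y z) * count (Contains? y z)
        ≡⟨ 𝟙*-cong (Distinct? x y z) (λ (x≢y , x≢z , y≢z) →
             trans (sym (length-filter-allFin (Contains? y z))) (sqs x y z x≢y x≢z y≢z)) ⟩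
      𝟙 (Distinct? x y z) * 1
        ≡⟨ *-identityʳ _ ⟩
      𝟙 (Distinct? x y z)
        ∎

  replication-constant : IsNestedSQS D → ∀ x x′ → replication x ≡ replication x′
  replication-constant sqs x x′ = *-cancelˡ-≡ _ _ 6 (trans (6*replication sqs x) (sym (6*replication sqs x′)))

  ndDegree-constant : IsNestedSQS D → IsUniform D → ∀ x x′ → ndDegree x ≡ ndDegree x′
  ndDegree-constant sqs (zero , uniform) x x′ = trans (no-ND-pairs x) (sym (no-ND-pairs x′))
    where
    no-ND-pairs : ∀ x → ndDegree x ≡ 0
    no-ND-pairs x = count-none (λ y → 1 ≤? multiplicity D x y) (λ y 1≤m →
      contradiction (subst (1 ≤_) (uniform x y (1≤multiplicity⇒IsNDPair 1≤m)) 1≤m) λ ())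
  ndDegree-constant sqs (suc λ₀ , uniform) x x′ = *-cancelʳ-≡ _ _ (suc λ₀) (begin
    ndDegree x * suc λ₀    ≡⟨ ndDegree*λ≡replication uniform x ⟩
    replication x          ≡⟨ replication-constant sqs x x′ ⟩
    replication x′         ≡⟨ ndDegree*λ≡replication uniform x′ ⟨
    ndDegree x′ * suc λ₀   ∎)

∣2*numNDPairs : (D : NestedDesign v) → IsNestedSQS D → IsUniform D → v ∣ 2 * numNDPairs D
∣2*numNDPairs {zero}  D _   _       = 0 ∣0
∣2*numNDPairs {suc v} D sqs uniform = divides (ndDegree D zero) (begin
  2 * numNDPairs D                  ≡⟨ 2*numNDPairs≡∑ndDegree D ⟩
  ∑[ x < suc v ] ndDegree D x       ≡⟨ sum-cong-≗ (λ x → ndDegree-constant D sqs uniform x zero) ⟩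
  ∑[ x < suc v ] ndDegree D zero    ≡⟨ ∑-const (suc v) (ndDegree D zero) ⟩
  suc v * ndDegree D zero           ≡⟨ *-comm (suc v) (ndDegree D zero) ⟩
  ndDegree D zero * suc v           ∎)

corollary4p14 : (v M : ℕ) → 1 ≤ v → v * (v ∸ 2) ≤ 4 * M → M ≤ v C 2 →
    Σ (NestedDesign v) (λ D → IsNestedSQS D × IsUniform D × numNDPairs D ≡ M) →
    v ∣ 2 * M
corollary4p14 v M _ _ _ (D , sqs , uniform , numNDPairs≡M) =
  subst (λ N → v ∣ 2 * N) numNDPairs≡M (∣2*numNDPairs D sqs uniform)
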